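{- Let $H$ be an essentially $2$-edge-connected multigraph and let $x \in V(H)$ with $d_H(x)\ge 2$. If $|E(H-\{x\})| \le 3$, then $H$ has a dominating closed trail containing $x$.
   Context: A multigraph may have multiple edges but no loops. A connected multigraph $H$ is essentially $k$-edge-connected if for every $F\subseteq E(H)$ with $|F|<k$, $H-F$ has at most one component containing an edge. $H-\{x\}$ denotes the multigraph obtained by deleting the vertex $x$. A closed trail $T$ in $H$ is a dominating closed trail if every edge of $H$ has at least one endvertex on $T$ (a single vertex counts as a trivial closed trail). -}

module Defs where

open import Data.Nat using (ℕ; _<_; _≤_)
open import Data.Fin using (Fin; _≟_)
open import Data.Fin.Subset using (Subset; ∣_∣; _∉_; ⊥)
open import Data.Product using (_×_; proj₁; proj₂; Σ; _,_)
open import Data.Sum using (_⊎_)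
open import Data.List using (List; []; _∷_; length; filter; allFin)
open import Data.List.Relation.Unary.All using (All)
open import Data.List.Relation.Unary.Unique.Propositional using (Unique)
open import Data.List.Membership.Propositional using (_∈_)
open import Relation.Binary.PropositionalEquality using (_≡_; _≢_)
open import Relation.Nullary using (Dec; ¬?)
open import Relation.Nullary.Decidable using (_⊎-dec_)

record Multigraph : Set where
  field
    n     : ℕ
    m     : ℕ
    ends  : Fin m → Fin n × Fin n
    loopless : ∀ e → proj₁ (ends e) ≢ proj₂ (ends e)
open Multigraph public

Vertex : Multigraph → Set
Vertex H = Fin (n H)

Edge : Multigraph → Set
Edge H = Fin (m H)

Joins : (H : Multigraph) → Edge H → Vertex H → Vertex H → Set
Joins H e u w = (ends H e ≡ (u , w)) ⊎ (ends H e ≡ (w , u))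

data Walk (H : Multigraph) : Vertex H → Vertex H → Set where
  nil  : ∀ v → Walk H v v
  cons : ∀ {u w v} (e : Edge H) → Joins H e u w → Walk H w v → Walk H u v

walkEdges : ∀ {H u v} → Walk H u v → List (Edge H)
walkEdges (nil _) = []
walkEdges (cons e _ w) = e ∷ walkEdges w

walkVertices : ∀ {H u v} → Walk H u v → List (Vertex H)
walkVertices (nil v) = v ∷ []
walkVertices {u = u} (cons e _ w) = u ∷ walkVertices w

ReachAvoiding : (H : Multigraph) → Subset (m H) → Vertex H → Vertex H → Set
ReachAvoiding H F u v = Σ (Walk H u v) λ w → All (λ e → e ∉ F) (walkEdges w)

Connected : Multigraph → Set
Connected H = ∀ u v → ReachAvoiding H ⊥ u v

-- essentially k-edge-connected: connected, and for every F with |F| < k,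
-- H - F has at most one component containing an edge, i.e. any two edges
-- of H - F lie in the same component of H - F.
EssKEdgeConnected : ℕ → Multigraph → Set
EssKEdgeConnected k H =
  Connected H ×
  (∀ (F : Subset (m H)) → ∣ F ∣ < k → ∀ (e f : Edge H) → e ∉ F → f ∉ F →
     ReachAvoiding H F (proj₁ (ends H e)) (proj₁ (ends H f)))

incident? : (H : Multigraph) (x : Vertex H) (e : Edge H) →
            Dec ((x ≡ proj₁ (ends H e)) ⊎ (x ≡ proj₂ (ends H e)))
incident? H x e = (x ≟ proj₁ (ends H e)) ⊎-dec (x ≟ proj₂ (ends H e))

-- degree of x (no loops, so = number of incident edges)
degree : (H : Multigraph) → Vertex H → ℕ
degree H x = length (filter (incident? H x) (allFin (m H)))

edgesMinusVertex : (H : Multigraph) → Vertex H → ℕ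
edgesMinusVertex H x = length (filter (λ e → ¬? (incident? H x e)) (allFin (m H)))

-- closed trail through v: closed walk with pairwise distinct edges
-- (nil v is the trivial closed trail)
ClosedTrail : (H : Multigraph) → Set
ClosedTrail H = Σ (Vertex H) λ v → Σ (Walk H v v) λ w → Unique (walkEdges w)

trailVertices : ∀ {H} → ClosedTrail H → List (Vertex H)
trailVertices (_ , w , _) = walkVertices w

Dominating : (H : Multigraph) → ClosedTrail H → Set
Dominating H T = ∀ (e : Edge H) →
  (proj₁ (ends H e) ∈ trailVertices T) ⊎ (proj₂ (ends H e) ∈ trailVertices T)

module Submission where

-- Let K be the set of (at most three) edges of H − x. A component of K with vertex set S can be
-- left only along edges into x, so essential 2-edge-connectivity gives two distinct edges
-- from S to x: a walk from S to an edge at x must leave S into x, and still does after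
-- the first such edge is deleted. Joining their ends by a trail inside the component that
-- dominates it closes up a trail through x. With at most three edges a component is a
-- star (possibly with parallel edges), a triangle or a path of length three; for the path,
-- and for a star whose two ears meet at a leaf, the ears are found by the same argument
-- applied to a part of S that is left through only one edge avoiding x. Trails of
-- different components meet only in x and are concatenated there.

open import Defs
open import Data.Nat using (_≤_; _<_; z≤n; s≤s)
open import Data.Fin using (_≟_)
open import Data.Fin.Subset using (Subset; ∣_∣; ⁅_⁆) renaming (⊥ to ∅; _∉_ to _∉ˢ_)
open import Data.Fin.Subset.Properties
  using (x≢y⇒x∉⁅y⁆; x∉⁅y⁆⇒x≢y; ∣⁅x⁆∣≡1; ∣⊥∣≡0) renaming (∉⊥ to ∉∅)
open import Data.Product using (_×_; proj₁; proj₂; Σ; _,_)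
open import Data.Sum using (_⊎_; inj₁; inj₂; [_,_]′; swap; map₂)
open import Data.Empty using (⊥; ⊥-elim)
open import Data.List using (List; []; _∷_; _++_; length; filter; allFin)
open import Data.List.Relation.Unary.All as All using (All; []; _∷_; all?)
import Data.List.Relation.Unary.All.Properties as All
open import Data.List.Relation.Unary.Any using (Any; here; there; any?)
import Data.List.Relation.Unary.Any.Properties as Any
open import Data.List.Relation.Unary.AllPairs using ([]; _∷_)
open import Data.List.Relation.Unary.Unique.Propositional using (Unique)
import Data.List.Relation.Unary.Unique.Propositional.Properties as Unique
open import Data.List.Membership.Propositional using (_∈_; _∉_; find; lose)
open import Data.List.Membership.Propositional.Properties using (∈-++⁻; ∈-filter⁺; ∈-allFin)
open import Data.List.Relation.Binary.Permutation.Propositional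
  using (_↭_; ↭-prep; ↭-swap; ↭-refl; ↭-trans)
open import Data.List.Relation.Binary.Permutation.Propositional.Properties using (∈-resp-↭)
open import Relation.Binary.PropositionalEquality using (_≡_; _≢_; refl; sym; trans; cong; subst; ≢-sym)
open import Relation.Nullary using (Dec; yes; no; ¬_; ¬?)
open import Relation.Nullary.Decidable using (_×-dec_; _⊎-dec_)
open import Relation.Unary using (Decidable; _⊆_)
open import Function using (_∘_)

module _ {A : Set} (a b c : A) where

  ↭-swap₁₂ : a ∷ b ∷ c ∷ [] ↭ b ∷ a ∷ c ∷ []
  ↭-swap₁₂ = ↭-swap a b ↭-refl

  ↭-swap₂₃ : a ∷ b ∷ c ∷ [] ↭ a ∷ c ∷ b ∷ []
  ↭-swap₂₃ = ↭-prep a (↭-swap b c ↭-refl)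

  ↭-rotate : a ∷ b ∷ c ∷ [] ↭ b ∷ c ∷ a ∷ []
  ↭-rotate = ↭-trans ↭-swap₁₂ (↭-prep b (↭-swap a c ↭-refl))

two-distinct : ∀ {A : Set} {P : A → Set} (xs : List A) → Unique xs → All P xs → 2 ≤ length xs →
               Σ A λ a → Σ A λ b → a ≢ b × P a × P b
two-distinct (a ∷ b ∷ _) ((a≢b ∷ _) ∷ _) (pa ∷ pb ∷ _) _ = a , b , a≢b , pa , pb
two-distinct (_ ∷ [])    _                _            (s≤s ())

module _ (H : Multigraph) where

  private
    V : Set
    V = Vertex H

    E : Set
    E = Edge H

  end₁ : E → V
  end₁ e = proj₁ (ends H e)

  end₂ : E → V
  end₂ e = proj₂ (ends H e)

  EndOf : E → V → Set
  EndOf e w = (w ≡ end₁ e) ⊎ (w ≡ end₂ e)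

  endOf? : ∀ e w → Dec (EndOf e w)
  endOf? e w = incident? H w e

  joins-sym : ∀ {e u w} → Joins H e u w → Joins H e w u
  joins-sym = swap

  joins⇒endOfˡ : ∀ {e u w} → Joins H e u w → EndOf e u
  joins⇒endOfˡ (inj₁ eq) = inj₁ (sym (cong proj₁ eq))
  joins⇒endOfˡ (inj₂ eq) = inj₂ (sym (cong proj₂ eq))

  joins⇒endOfʳ : ∀ {e u w} → Joins H e u w → EndOf e w
  joins⇒endOfʳ j = joins⇒endOfˡ (joins-sym j)

  joins⇒≢ : ∀ {e u w} → Joins H e u w → u ≢ w
  joins⇒≢ {e} (inj₁ eq) refl = loopless H e (trans (cong proj₁ eq) (sym (cong proj₂ eq)))
  joins⇒≢ {e} (inj₂ eq) refl = loopless H e (trans (cong proj₁ eq) (sym (cong proj₂ eq)))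

  joins-endOf : ∀ {e u w y} → Joins H e u w → EndOf e y → (y ≡ u) ⊎ (y ≡ w)
  joins-endOf (inj₁ eq) (inj₁ y≡) = inj₁ (trans y≡ (cong proj₁ eq))
  joins-endOf (inj₁ eq) (inj₂ y≡) = inj₂ (trans y≡ (cong proj₂ eq))
  joins-endOf (inj₂ eq) (inj₁ y≡) = inj₂ (trans y≡ (cong proj₁ eq))
  joins-endOf (inj₂ eq) (inj₂ y≡) = inj₁ (trans y≡ (cong proj₂ eq))

  endOf⇒joins : ∀ {e u w} → EndOf e u → EndOf e w → u ≢ w → Joins H e u w
  endOf⇒joins (inj₁ refl) (inj₁ refl) u≢w = ⊥-elim (u≢w refl)
  endOf⇒joins (inj₁ refl) (inj₂ refl) _   = inj₁ refl
  endOf⇒joins (inj₂ refl) (inj₁ refl) _   = inj₂ refl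
  endOf⇒joins (inj₂ refl) (inj₂ refl) u≢w = ⊥-elim (u≢w refl)

  joins-≢ : ∀ {e e' u w u' w'} → Joins H e u w → Joins H e' u' w' → w' ≢ u → w' ≢ w → e ≢ e'
  joins-≢ j j' w'≢u w'≢w e≡e' =
    [ w'≢u , w'≢w ]′ (joins-endOf j (subst (λ d → EndOf d _) (sym e≡e') (joins⇒endOfʳ j')))

  other-end : ∀ {e u} → EndOf e u → Σ V λ w → Joins H e u w
  other-end {e} (inj₁ refl) = end₂ e , inj₁ refl
  other-end {e} (inj₂ refl) = end₁ e , inj₂ refl

  Touches : List E → V → Set
  Touches K w = Any (λ e → EndOf e w) K

  touches? : ∀ K → Decidable (Touches K)
  touches? K w = any? (λ e → endOf? e w) K

  ShareEnd : E → E → Set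
  ShareEnd c c' = Σ V λ y → EndOf c y × EndOf c' y

  shareEnd? : ∀ c c' → Dec (ShareEnd c c')
  shareEnd? c c' with endOf? c' (end₁ c) | endOf? c' (end₂ c)
  ... | yes i  | _      = yes (end₁ c , inj₁ refl , i)
  ... | no _   | yes i  = yes (end₂ c , inj₂ refl , i)
  ... | no ¬i₁ | no ¬i₂ = no λ { (_ , inj₁ refl , i) → ¬i₁ i ; (_ , inj₂ refl , i) → ¬i₂ i }

  shareEnd-sym : ∀ {c c'} → ShareEnd c c' → ShareEnd c' c
  shareEnd-sym (y , cy , c'y) = y , c'y , cy

  CommonEnd : E → E → E → Set
  CommonEnd a b c = Σ V λ y → EndOf a y × EndOf b y × EndOf c y

  commonEnd? : ∀ a b c → Dec (CommonEnd a b c)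
  commonEnd? a b c with endOf? b (end₁ a) ×-dec endOf? c (end₁ a)
                     | endOf? b (end₂ a) ×-dec endOf? c (end₂ a)
  ... | yes (i , k) | _           = yes (end₁ a , inj₁ refl , i , k)
  ... | no _        | yes (i , k) = yes (end₂ a , inj₂ refl , i , k)
  ... | no ¬i₁      | no ¬i₂      =
    no λ { (_ , inj₁ refl , i , k) → ¬i₁ (i , k) ; (_ , inj₂ refl , i , k) → ¬i₂ (i , k) }

  Apart : List E → List E → Set
  Apart K₁ K₂ = All (λ c → All (λ c' → ¬ ShareEnd c c') K₂) K₁

  apart⇒disjoint : ∀ {K₁ K₂ u} → Apart K₁ K₂ → Touches K₁ u → Touches K₂ u → ⊥
  apart⇒disjoint apart t₁ t₂ with find t₁ | find t₂
  ... | _ , c∈ , cu | _ , c'∈ , c'u = All.lookup (All.lookup apart c∈) c'∈ (_ , cu , c'u)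

  _++ʷ_ : ∀ {u v w} → Walk H u v → Walk H v w → Walk H u w
  nil _      ++ʷ Q = Q
  cons e j P ++ʷ Q = cons e j (P ++ʷ Q)

  walkEdges-++ : ∀ {u v w} (P : Walk H u v) (Q : Walk H v w) →
                 walkEdges (P ++ʷ Q) ≡ walkEdges P ++ walkEdges Q
  walkEdges-++ (nil _)      Q = refl
  walkEdges-++ (cons e j P) Q = cong (e ∷_) (walkEdges-++ P Q)

  start∈walkVertices : ∀ {u v} (P : Walk H u v) → u ∈ walkVertices P
  start∈walkVertices (nil _)      = here refl
  start∈walkVertices (cons _ _ _) = here refl

  end∈walkVertices : ∀ {u v} (P : Walk H u v) → v ∈ walkVertices P
  end∈walkVertices (nil _)      = here refl
  end∈walkVertices (cons _ _ P) = there (end∈walkVertices P)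

  ∈walkVertices-++ˡ : ∀ {u v w y} (P : Walk H u v) (Q : Walk H v w) →
                      y ∈ walkVertices P → y ∈ walkVertices (P ++ʷ Q)
  ∈walkVertices-++ˡ (nil _)      Q (here refl) = start∈walkVertices Q
  ∈walkVertices-++ˡ (cons _ _ P) Q (here refl) = here refl
  ∈walkVertices-++ˡ (cons _ _ P) Q (there i)   = there (∈walkVertices-++ˡ P Q i)

  ∈walkVertices-++ʳ : ∀ {u v w y} (P : Walk H u v) (Q : Walk H v w) →
                      y ∈ walkVertices Q → y ∈ walkVertices (P ++ʷ Q)
  ∈walkVertices-++ʳ (nil _)      Q i = i
  ∈walkVertices-++ʳ (cons _ _ P) Q i = there (∈walkVertices-++ʳ P Q i)

  crossing-edge : ∀ {S : V → Set} → Decidable S → ∀ {u v} (P : Walk H u v) → S u → ¬ S v →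
    Σ E λ d → d ∈ walkEdges P × Σ V λ a → Σ V λ b → Joins H d a b × S a × ¬ S b
  crossing-edge S? (nil _) Su ¬Sv = ⊥-elim (¬Sv Su)
  crossing-edge S? (cons {w = w} e j P) Su ¬Sv with S? w
  ... | yes Sw = let (d , d∈ , rest) = crossing-edge S? P Sw ¬Sv in d , there d∈ , rest
  ... | no ¬Sw = e , here refl , _ , _ , j , Su , ¬Sw

  module _ (x : V) where

    AtX : E → Set
    AtX e = EndOf e x

    DominatingTrailThrough : Set
    DominatingTrailThrough = Σ (ClosedTrail H) λ T → Dominating H T × (x ∈ trailVertices T)

    Covers : List E → Set
    Covers K = ∀ d → ¬ AtX d → d ∈ K

    covers-↭ : ∀ {K K'} → K ↭ K' → Covers K → Covers K'
    covers-↭ K↭K' cov d ¬dx = ∈-resp-↭ K↭K' (cov d ¬dx)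

    -- K is a union of components of H − x.
    Saturated : List E → Set
    Saturated K = ∀ {d u} → ¬ AtX d → EndOf d u → Touches K u → d ∈ K

    covers⇒saturated : ∀ {K} → Covers K → Saturated K
    covers⇒saturated cov ¬dx _ _ = cov _ ¬dx

    saturated-++ˡ : ∀ {K₁ K₂} → Apart K₁ K₂ → Saturated (K₁ ++ K₂) → Saturated K₁
    saturated-++ˡ {K₁} ap sat ¬dx du t with ∈-++⁻ K₁ (sat ¬dx du (Any.++⁺ˡ t))
    ... | inj₁ d∈ = d∈
    ... | inj₂ d∈ = ⊥-elim (apart⇒disjoint ap t (lose d∈ du))

    saturated-++ʳ : ∀ {K₁ K₂} → Apart K₁ K₂ → Saturated (K₁ ++ K₂) → Saturated K₂
    saturated-++ʳ {K₁} ap sat ¬dx du t with ∈-++⁻ K₁ (sat ¬dx du (Any.++⁺ʳ K₁ t))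
    ... | inj₁ d∈ = ⊥-elim (apart⇒disjoint ap (lose d∈ du) t)
    ... | inj₂ d∈ = d∈

    ClosedOutside : Subset (m H) → (V → Set) → Set
    ClosedOutside F S = ∀ {d a b} → d ∉ˢ F → Joins H d a b → S a → ¬ S b → b ≡ x

    ClosedExcept : E → (V → Set) → Set
    ClosedExcept f S = ∀ {d a b} → d ≢ f → Joins H d a b → S a → ¬ S b → b ≡ x

    Closed : (V → Set) → Set
    Closed S = ∀ {d a b} → Joins H d a b → S a → ¬ S b → b ≡ x

    enters-x : ∀ (S : V → Set) {d a b} → ¬ S x → Joins H d a b → S a → AtX d → b ≡ x
    enters-x S ¬Sx j Sa dx =
      [ (λ x≡a → ⊥-elim (¬Sx (subst S (sym x≡a) Sa))) , sym ]′ (joins-endOf j dx)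

    touches-x : ∀ {K} → All (λ e → ¬ AtX e) K → ¬ Touches K x
    touches-x ¬x t with find t
    ... | _ , e∈ , ex = All.lookup ¬x e∈ ex

    saturated⇒closed : ∀ {K} → All (λ e → ¬ AtX e) K → Saturated K → Closed (Touches K)
    saturated⇒closed {K} ¬x sat {d} j Sa ¬Sb with endOf? d x
    ... | yes dx  = enters-x (Touches K) (touches-x ¬x) j Sa dx
    ... | no ¬dx = ⊥-elim (¬Sb (lose (sat ¬dx (joins⇒endOfˡ j) Sa) (joins⇒endOfʳ j)))

    Within : (V → Set) → E → Set
    Within S d = ∀ {u} → EndOf d u → (u ≡ x) ⊎ S u

    within-joins : ∀ {S d a b} → Joins H d a b → S a → S b → Within S d
    within-joins {S} j Sa Sb du =
      [ (λ u≡a → inj₂ (subst S (sym u≡a) Sa)) , (λ u≡b → inj₂ (subst S (sym u≡b) Sb)) ]′ (joins-endOf j du)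

    within-joins-x : ∀ {S d a} → Joins H d a x → S a → Within S d
    within-joins-x {S} j Sa du = [ (λ u≡a → inj₂ (subst S (sym u≡a) Sa)) , inj₁ ]′ (joins-endOf j du)

    within-mono : ∀ {S S' d} → S ⊆ S' → Within S d → Within S' d
    within-mono S⊆S' w du = [ inj₁ , (λ Su → inj₂ (S⊆S' Su)) ]′ (w du)

    within-disjoint⇒x : ∀ {S₁ S₂ d u} → (∀ {v} → S₁ v → S₂ v → ⊥) →
                        Within S₁ d → Within S₂ d → EndOf d u → u ≡ x
    within-disjoint⇒x disjoint w₁ w₂ du with w₁ du | w₂ du
    ... | inj₁ u≡x | _         = u≡x
    ... | inj₂ _   | inj₁ u≡x  = u≡x
    ... | inj₂ S₁u | inj₂ S₂u  = ⊥-elim (disjoint S₁u S₂u)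

    record InnerTrail (S : V → Set) (u w : V) : Set where
      constructor mkInnerTrail
      field
        walk    : Walk H u w
        unique  : Unique (walkEdges walk)
        avoidsX : All (λ e → ¬ AtX e) (walkEdges walk)
        within  : All (Within S) (walkEdges walk)

    stay : ∀ {S} u → InnerTrail S u u
    stay u = mkInnerTrail (nil u) [] [] []

    step : ∀ {S u w z e} → Joins H e u w → ¬ AtX e → Within S e → (P : InnerTrail S w z) →
           e ∉ walkEdges (InnerTrail.walk P) → InnerTrail S u z
    step {e = e} j ¬ex we (mkInnerTrail P uniq ¬x wi) e∉ =
      mkInnerTrail (cons e j P) (All.¬Any⇒All¬ _ e∉ ∷ uniq) (¬ex ∷ ¬x) (we ∷ wi)

    edge-trail : ∀ {S u w e} → Joins H e u w → ¬ AtX e → Within S e → InnerTrail S u w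
    edge-trail j ¬ex we = step j ¬ex we (stay _) λ ()

    ∉₁ : ∀ {e a : E} → e ≢ a → e ∉ a ∷ []
    ∉₁ e≢a (here eq) = e≢a eq

    ∉₂ : ∀ {e a b : E} → e ≢ a → e ≢ b → e ∉ a ∷ b ∷ []
    ∉₂ e≢a _ (here eq)         = e≢a eq
    ∉₂ _ e≢b (there (here eq)) = e≢b eq

    DominatedBy : List E → List V → Set
    DominatedBy K vs = All (λ e → (end₁ e ∈ vs) ⊎ (end₂ e ∈ vs)) K

    endOf-dominates : ∀ {e y vs} → EndOf e y → y ∈ vs → (end₁ e ∈ vs) ⊎ (end₂ e ∈ vs)
    endOf-dominates {vs = vs} (inj₁ eq) y∈ = inj₁ (subst (_∈ vs) eq y∈)
    endOf-dominates {vs = vs} (inj₂ eq) y∈ = inj₂ (subst (_∈ vs) eq y∈)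

    dominated-at : ∀ {K vs y} → All (λ e → EndOf e y) K → y ∈ vs → DominatedBy K vs
    dominated-at ends y∈ = All.map (λ ey → endOf-dominates ey y∈) ends

    dominated-mono : ∀ {K vs ws} → (∀ {y} → y ∈ vs → y ∈ ws) → DominatedBy K vs → DominatedBy K ws
    dominated-mono vs⊆ws = All.map [ (λ i → inj₁ (vs⊆ws i)) , (λ i → inj₂ (vs⊆ws i)) ]′

    record Tour (S : V → Set) (K : List E) : Set where
      constructor mkTour
      field
        walk      : Walk H x x
        unique    : Unique (walkEdges walk)
        within    : All (Within S) (walkEdges walk)
        dominates : DominatedBy K (walkVertices walk)

    ear : ∀ {S K a b g h} → g ≢ h → Joins H g a x → S a → Joins H h b x → S b →
          (P : InnerTrail S a b) → DominatedBy K (walkVertices (InnerTrail.walk P)) → Tour S K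
    ear {S} {g = g} {h} g≢h jg Sa jh Sb (mkInnerTrail P uniq ¬x wi) domP =
      mkTour (cons g (joins-sym jg) (P ++ʷ Q)) unique within
           (dominated-mono (λ i → there (∈walkVertices-++ˡ P Q i)) domP)
      where
      Q : Walk H _ x
      Q = cons h jh (nil x)

      unique : Unique (g ∷ walkEdges (P ++ʷ Q))
      unique rewrite walkEdges-++ P Q =
        All.++⁺ (All.map (λ ¬ex g≡e → ¬ex (subst AtX g≡e (joins⇒endOfʳ jg))) ¬x) (g≢h ∷ [])
        ∷ Unique.++⁺ uniq ([] ∷ []) λ { (i , here refl) → All.lookup ¬x i (joins⇒endOfʳ jh) }

      within : All (Within S) (g ∷ walkEdges (P ++ʷ Q))
      within rewrite walkEdges-++ P Q = within-joins-x jg Sa ∷ All.++⁺ wi (within-joins-x jh Sb ∷ [])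

    tour-++ : ∀ {S₁ S₂ S K₁ K₂} → (∀ {u} → S₁ u → S₂ u → ⊥) → S₁ ⊆ S → S₂ ⊆ S →
              Tour S₁ K₁ → Tour S₂ K₂ → Tour S (K₁ ++ K₂)
    tour-++ {S₁} {S₂} {S} disjoint S₁⊆S S₂⊆S (mkTour w₁ uniq₁ wi₁ dom₁) (mkTour w₂ uniq₂ wi₂ dom₂) =
      mkTour (w₁ ++ʷ w₂) unique within
           (All.++⁺ (dominated-mono (∈walkVertices-++ˡ w₁ w₂) dom₁)
                    (dominated-mono (∈walkVertices-++ʳ w₁ w₂) dom₂))
      where
      unique : Unique (walkEdges (w₁ ++ʷ w₂))
      unique rewrite walkEdges-++ w₁ w₂ = Unique.++⁺ uniq₁ uniq₂ λ { {d} (i₁ , i₂) →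
        loopless H d (trans (at-x (All.lookup wi₁ i₁) (All.lookup wi₂ i₂) (inj₁ refl))
                       (sym (at-x (All.lookup wi₁ i₁) (All.lookup wi₂ i₂) (inj₂ refl)))) }
        where
        at-x : ∀ {d u} → Within S₁ d → Within S₂ d → EndOf d u → u ≡ x
        at-x = within-disjoint⇒x disjoint

      within : All (Within S) (walkEdges (w₁ ++ʷ w₂))
      within rewrite walkEdges-++ w₁ w₂ =
        All.++⁺ (All.map (within-mono S₁⊆S) wi₁) (All.map (within-mono S₂⊆S) wi₂)

    tour⇒trail : ∀ {S K} → Covers K → Tour S K → DominatingTrailThrough
    tour⇒trail cov (mkTour w uniq _ dom) = (x , w , uniq) , dominating , start∈walkVertices w
      where
      dominating : Dominating H (x , w , uniq)
      dominating d with endOf? d x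
      ... | yes dx  = endOf-dominates dx (start∈walkVertices w)
      ... | no ¬dx = All.lookup dom (cov d ¬dx)

    Solvable : List E → Set
    Solvable K = Saturated K → Tour (Touches K) K

    solvable-++ : ∀ {K₁ K₂} → Apart K₁ K₂ → Solvable K₁ → Solvable K₂ → Solvable (K₁ ++ K₂)
    solvable-++ {K₁} ap s₁ s₂ sat =
      tour-++ (apart⇒disjoint ap) Any.++⁺ˡ (Any.++⁺ʳ K₁)
              (s₁ (saturated-++ˡ ap sat)) (s₂ (saturated-++ʳ ap sat))

    solvable⇒trail : ∀ {K} → Covers K → Solvable K → DominatingTrailThrough
    solvable⇒trail cov s = tour⇒trail cov (s (covers⇒saturated cov))

    module _ (ess : EssKEdgeConnected 2 H)
             {g₁ g₂ : E} (g₁≢g₂ : g₁ ≢ g₂) (g₁x : AtX g₁) (g₂x : AtX g₂) where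

      private
        ∣∅∣<2 : ∣ ∅ {m H} ∣ < 2
        ∣∅∣<2 = subst (_< 2) (sym (∣⊥∣≡0 (m H))) (s≤s z≤n)

        ∣⁅_⁆∣<2 : ∀ (f : E) → ∣ ⁅ f ⁆ ∣ < 2
        ∣⁅ f ⁆∣<2 = subst (_< 2) (sym (∣⁅x⁆∣≡1 f)) (s≤s (s≤s z≤n))

      x-edge-avoiding : ∀ f → Σ E λ h → h ≢ f × AtX h
      x-edge-avoiding f with g₁ ≟ f
      ... | yes refl = g₂ , ≢-sym g₁≢g₂ , g₂x
      ... | no g₁≢f  = g₁ , g₁≢f , g₁x

      -- If the other end of h lies outside S, a walk in H − F from the end of e in S
      -- to the end of h outside S leaves S somewhere, and closedness says it leaves into x.
      edge-into-x : ∀ {S} → Decidable S → ¬ S x → ∀ F → ∣ F ∣ < 2 → ClosedOutside F S →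
                    ∀ e → e ∉ˢ F → S (end₁ e) → ∀ h → h ∉ˢ F → AtX h →
                    Σ E λ d → Σ V λ a → d ∉ˢ F × Joins H d a x × S a
      edge-into-x {S} S? ¬Sx F |F|<2 closed e e∉ Se h h∉ hx with other-end hx
      ... | a , jh with S? a
      ... | yes Sa = h , a , h∉ , joins-sym jh , Sa
      ... | no ¬Sa with proj₂ ess F |F|<2 e h e∉ h∉
      ... | w , w∉ with crossing-edge S? w Se
                          (λ Sh → [ (λ h₁≡x → ¬Sx (subst S h₁≡x Sh)) , (λ h₁≡a → ¬Sa (subst S h₁≡a Sh)) ]′
                                  (joins-endOf jh (inj₁ refl)))
      ... | d , d∈ , _ , _ , jd , Sa' , ¬Sb' =
        d , _ , All.lookup w∉ d∈ , subst (Joins H d _) (closed (All.lookup w∉ d∈) jd Sa' ¬Sb') jd , Sa'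

      two-edges-into-x : ∀ {S} → Decidable S → ¬ S x → Closed S → ∀ e → ¬ AtX e → S (end₁ e) →
        Σ E λ g → Σ E λ h → Σ V λ a → Σ V λ b → g ≢ h × Joins H g a x × S a × Joins H h b x × S b
      two-edges-into-x S? ¬Sx closed e ¬ex Se
        with edge-into-x S? ¬Sx ∅ ∣∅∣<2 (λ _ → closed) e ∉∅ Se g₁ ∉∅ g₁x
      ... | g , a , _ , jg , Sa with x-edge-avoiding g
      ... | h₀ , h₀≢g , h₀x
        with edge-into-x S? ¬Sx ⁅ g ⁆ ∣⁅ g ⁆∣<2 (λ _ → closed)
                         e (x≢y⇒x∉⁅y⁆ e≢g) Se h₀ (x≢y⇒x∉⁅y⁆ h₀≢g) h₀x
        where
        e≢g : e ≢ g
        e≢g e≡g = ¬ex (subst AtX (sym e≡g) (joins⇒endOfʳ jg))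
      ... | h , b , h∉ , jh , Sb = g , h , a , b , ≢-sym (x∉⁅y⁆⇒x≢y h∉) , jg , Sa , jh , Sb

      edge-into-x-avoiding : ∀ {S} → Decidable S → ¬ S x → ∀ f → ClosedExcept f S →
                             ∀ e → e ≢ f → S (end₁ e) → Σ E λ d → Σ V λ a → Joins H d a x × S a
      edge-into-x-avoiding S? ¬Sx f closed e e≢f Se with x-edge-avoiding f
      ... | h , h≢f , hx
        with edge-into-x S? ¬Sx ⁅ f ⁆ ∣⁅ f ⁆∣<2 (λ d∉ → closed (x∉⁅y⁆⇒x≢y d∉))
                         e (x≢y⇒x∉⁅y⁆ e≢f) Se h (x≢y⇒x∉⁅y⁆ h≢f) hx
      ... | d , a , _ , jd , Sa = d , a , jd , Sa

      module Star (v : V) (K : List E) {e₀ : E} (e₀∈K : e₀ ∈ K) (spokes : All (λ e → EndOf e v) K)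
                  (¬x : All (λ e → ¬ AtX e) K) (sat : Saturated K) where

        S : V → Set
        S = Touches K

        ¬Sx : ¬ S x
        ¬Sx = touches-x ¬x

        within-K : ∀ {e} → e ∈ K → Within S e
        within-K e∈ eu = inj₂ (lose e∈ eu)

        spoke-trail : ∀ {e u w} → e ∈ K → Joins H e u w → InnerTrail S u w
        spoke-trail e∈ j = edge-trail j (All.lookup ¬x e∈) (within-K e∈)

        spoke : ∀ {b} → S b → b ≢ v → Σ E λ e → e ∈ K × Joins H e v b
        spoke Sb b≢v with find Sb
        ... | e , e∈ , eb = e , e∈ , endOf⇒joins (All.lookup spokes e∈) eb (≢-sym b≢v)

        from-centre : ∀ {b} → S b → InnerTrail S v b
        from-centre {b} Sb with b ≟ v
        ... | yes refl = stay v
        ... | no b≢v with spoke Sb b≢v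
        ... | _ , e∈ , j = spoke-trail e∈ j

        to-centre : ∀ {a} → S a → InnerTrail S a v
        to-centre {a} Sa with a ≟ v
        ... | yes refl = stay v
        ... | no a≢v with spoke Sa a≢v
        ... | _ , e∈ , j = spoke-trail e∈ (joins-sym j)

        through-centre : ∀ {a b ea eb} → ea ∈ K → Joins H ea v a → eb ∈ K → Joins H eb v b → ea ≢ eb →
                         InnerTrail S a b
        through-centre ea∈ ja eb∈ jb ea≢eb =
          step (joins-sym ja) (All.lookup ¬x ea∈) (within-K ea∈) (spoke-trail eb∈ jb) (∉₁ ea≢eb)

        -- Both ears end at the leaf a and ea is its only spoke. Apart from edges into x, the
        -- star minus a is left only through ea, which yields a second ear away from a.
        module Detour {a ea} (a≢v : a ≢ v) (ea∈ : ea ∈ K) (ja : Joins H ea v a)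
                      (¬second : ¬ Any (λ e → e ≢ ea × EndOf e a) K) where

          S' : V → Set
          S' w = S w × w ≢ a

          closed' : ClosedExcept ea S'
          closed' {d} {b = b} d≢ea jd (Sa' , _) ¬S'b with endOf? d x
          ... | yes dx = enters-x S ¬Sx jd Sa' dx
          ... | no ¬dx with sat ¬dx (joins⇒endOfˡ jd) Sa' | b ≟ a
          ... | d∈ | yes refl = ⊥-elim (¬second (lose d∈ (d≢ea , joins⇒endOfʳ jd)))
          ... | d∈ | no b≢a   = ⊥-elim (¬S'b (lose d∈ (joins⇒endOfʳ jd) , b≢a))

          detour : ∀ {a'} → S a' → a' ≢ a →
                   Σ (InnerTrail S a a') λ P → v ∈ walkVertices (InnerTrail.walk P)
          detour {a'} Sa' a'≢a with a' ≟ v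
          ... | yes refl = spoke-trail ea∈ (joins-sym ja) , there (here refl)
          ... | no a'≢v with spoke Sa' a'≢v
          ... | _ , eb∈ , jb = through-centre ea∈ ja eb∈ jb (joins-≢ ja jb a'≢v a'≢a) , there (here refl)

          tour : ∀ {g e} → Joins H g a x → S a → e ∈ K → ¬ EndOf e a → Tour S K
          tour jg Sa e∈ ¬ea
            with edge-into-x-avoiding (λ w → touches? K w ×-dec ¬? (w ≟ a)) (λ S'x → ¬Sx (proj₁ S'x))
                                      ea closed'
                   _ (λ e≡ea → ¬ea (subst (λ d → EndOf d a) (sym e≡ea) (joins⇒endOfʳ ja)))
                   (lose e∈ (inj₁ refl) , λ e₁≡a → ¬ea (inj₁ (sym e₁≡a)))
          ... | d , a' , jd , Sa' , a'≢a with detour Sa' a'≢a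
          ... | P , v∈P =
            ear (joins-≢ jg (joins-sym jd) a'≢a (λ a'≡x → ¬Sx (subst S a'≡x Sa'))) jg Sa jd Sa' P
                (dominated-at spokes v∈P)

        leaf-tour : ∀ {a g h} → g ≢ h → Joins H g a x → Joins H h a x → S a → a ≢ v → Tour S K
        leaf-tour {a} g≢h jg jh Sa a≢v with spoke Sa a≢v
        ... | ea , ea∈ , ja with any? (λ e → ¬? (e ≟ ea) ×-dec endOf? e a) K
        ... | yes second with find second
        ... | e' , e'∈ , e'≢ea , e'a =
          ear g≢h jg Sa jh Sa
              (through-centre ea∈ ja e'∈ (endOf⇒joins (All.lookup spokes e'∈) e'a (≢-sym a≢v)) (≢-sym e'≢ea))
              (dominated-at spokes (there (here refl)))
        leaf-tour {a} g≢h jg jh Sa a≢v | ea , ea∈ , ja | no ¬second with all? (λ e → endOf? e a) K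
        ... | yes all-at-a = ear g≢h jg Sa jh Sa (stay a) (dominated-at all-at-a (here refl))
        ... | no ¬all-at-a with find (All.¬All⇒Any¬ (λ e → endOf? e a) K ¬all-at-a)
        ... | _ , e∈ , ¬ea = Detour.tour a≢v ea∈ ja ¬second jg Sa e∈ ¬ea

        tour : Tour S K
        tour with two-edges-into-x (touches? K) ¬Sx (saturated⇒closed ¬x sat)
                                   e₀ (All.lookup ¬x e₀∈K) (lose e₀∈K (inj₁ refl))
        ... | g , h , a , b , g≢h , jg , Sa , jh , Sb with a ≟ v | b ≟ v
        ... | yes refl | _ = ear g≢h jg Sa jh Sb (from-centre Sb) (dominated-at spokes (start∈walkVertices _))
        ... | no _ | yes refl = ear g≢h jg Sa jh Sb (to-centre Sa) (dominated-at spokes (end∈walkVertices _))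
        ... | no a≢v | no b≢v with a ≟ b
        ... | yes refl = leaf-tour g≢h jg jh Sa a≢v
        ... | no a≢b with spoke Sa a≢v | spoke Sb b≢v
        ... | _ , ea∈ , ja | _ , eb∈ , jb =
          ear g≢h jg Sa jh Sb (through-centre ea∈ ja eb∈ jb (joins-≢ ja jb b≢v (≢-sym a≢b)))
              (dominated-at spokes (there (here refl)))

      star : ∀ v {K e₀} → e₀ ∈ K → All (λ e → EndOf e v) K → All (λ e → ¬ AtX e) K → Solvable K
      star v e₀∈K spokes ¬x sat = Star.tour v _ e₀∈K spokes ¬x sat

      module Triangle {u v w c₁ c₂ c₃} (j₁ : Joins H c₁ u v) (j₂ : Joins H c₂ v w) (j₃ : Joins H c₃ w u)
                      (¬x₁ : ¬ AtX c₁) (¬x₂ : ¬ AtX c₂) (¬x₃ : ¬ AtX c₃)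
                      (cov : Covers (c₁ ∷ c₂ ∷ c₃ ∷ [])) where

        K : List E
        K = c₁ ∷ c₂ ∷ c₃ ∷ []

        S : V → Set
        S y = (y ≡ u) ⊎ (y ≡ v) ⊎ (y ≡ w)

        S? : Decidable S
        S? y = (y ≟ u) ⊎-dec ((y ≟ v) ⊎-dec (y ≟ w))

        Su : S u
        Su = inj₁ refl

        Sv : S v
        Sv = inj₂ (inj₁ refl)

        Sw : S w
        Sw = inj₂ (inj₂ refl)

        ¬Sx : ¬ S x
        ¬Sx (inj₁ refl)        = ¬x₁ (joins⇒endOfˡ j₁)
        ¬Sx (inj₂ (inj₁ refl)) = ¬x₂ (joins⇒endOfˡ j₂)
        ¬Sx (inj₂ (inj₂ refl)) = ¬x₃ (joins⇒endOfˡ j₃)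

        corner : ∀ {d y} → d ∈ K → EndOf d y → S y
        corner (here refl)                 dy = map₂ inj₁ (joins-endOf j₁ dy)
        corner (there (here refl))         dy = inj₂ (joins-endOf j₂ dy)
        corner (there (there (here refl))) dy = [ inj₂ ∘ inj₂ , inj₁ ]′ (joins-endOf j₃ dy)

        closed : Closed S
        closed {d} jd Sa ¬Sb with endOf? d x
        ... | yes dx  = enters-x S ¬Sx jd Sa dx
        ... | no ¬dx = ⊥-elim (¬Sb (corner (cov d ¬dx) (joins⇒endOfʳ jd)))

        c₁≢c₂ : c₁ ≢ c₂
        c₁≢c₂ = joins-≢ j₁ j₂ (joins⇒≢ j₃) (≢-sym (joins⇒≢ j₂))

        c₂≢c₃ : c₂ ≢ c₃
        c₂≢c₃ = joins-≢ j₂ j₃ (joins⇒≢ j₁) (≢-sym (joins⇒≢ j₃))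

        c₃≢c₁ : c₃ ≢ c₁
        c₃≢c₁ = joins-≢ j₃ j₁ (joins⇒≢ j₂) (≢-sym (joins⇒≢ j₁))

        within₁ : Within S c₁
        within₁ = within-joins j₁ Su Sv

        within₂ : Within S c₂
        within₂ = within-joins j₂ Sv Sw

        within₃ : Within S c₃
        within₃ = within-joins j₃ Sw Su

        side₁ : ∀ {y z} → Joins H c₁ y z → InnerTrail S y z
        side₁ j = edge-trail j ¬x₁ within₁

        side₂ : ∀ {y z} → Joins H c₂ y z → InnerTrail S y z
        side₂ j = edge-trail j ¬x₂ within₂

        side₃ : ∀ {y z} → Joins H c₃ y z → InnerTrail S y z
        side₃ j = edge-trail j ¬x₃ within₃

        loop-u : InnerTrail S u u
        loop-u = step j₁ ¬x₁ within₁ (step j₂ ¬x₂ within₂ (side₃ j₃) (∉₁ c₂≢c₃))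
                      (∉₂ c₁≢c₂ (≢-sym c₃≢c₁))

        loop-v : InnerTrail S v v
        loop-v = step j₂ ¬x₂ within₂ (step j₃ ¬x₃ within₃ (side₁ j₁) (∉₁ c₃≢c₁))
                      (∉₂ c₂≢c₃ (≢-sym c₁≢c₂))

        loop-w : InnerTrail S w w
        loop-w = step j₃ ¬x₃ within₃ (step j₁ ¬x₁ within₁ (side₂ j₂) (∉₁ c₁≢c₂))
                      (∉₂ c₃≢c₁ (≢-sym c₂≢c₃))

        dominated-uv : ∀ {vs} → u ∈ vs → v ∈ vs → DominatedBy K vs
        dominated-uv iu iv = endOf-dominates (joins⇒endOfˡ j₁) iu ∷ endOf-dominates (joins⇒endOfˡ j₂) iv
                           ∷ endOf-dominates (joins⇒endOfʳ j₃) iu ∷ []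

        dominated-vw : ∀ {vs} → v ∈ vs → w ∈ vs → DominatedBy K vs
        dominated-vw iv iw = endOf-dominates (joins⇒endOfʳ j₁) iv ∷ endOf-dominates (joins⇒endOfˡ j₂) iv
                           ∷ endOf-dominates (joins⇒endOfˡ j₃) iw ∷ []

        dominated-wu : ∀ {vs} → w ∈ vs → u ∈ vs → DominatedBy K vs
        dominated-wu iw iu = endOf-dominates (joins⇒endOfˡ j₁) iu ∷ endOf-dominates (joins⇒endOfʳ j₂) iw
                           ∷ endOf-dominates (joins⇒endOfˡ j₃) iw ∷ []

        corner-trail : ∀ {a b} → S a → S b →
                       Σ (InnerTrail S a b) λ P → DominatedBy K (walkVertices (InnerTrail.walk P))
        corner-trail (inj₁ refl)        (inj₁ refl)        = loop-u , dominated-uv (here refl) (there (here refl))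
        corner-trail (inj₁ refl)        (inj₂ (inj₁ refl)) = side₁ j₁ , dominated-uv (here refl) (there (here refl))
        corner-trail (inj₁ refl)        (inj₂ (inj₂ refl)) = side₃ (joins-sym j₃) , dominated-wu (there (here refl)) (here refl)
        corner-trail (inj₂ (inj₁ refl)) (inj₁ refl)        = side₁ (joins-sym j₁) , dominated-uv (there (here refl)) (here refl)
        corner-trail (inj₂ (inj₁ refl)) (inj₂ (inj₁ refl)) = loop-v , dominated-vw (here refl) (there (here refl))
        corner-trail (inj₂ (inj₁ refl)) (inj₂ (inj₂ refl)) = side₂ j₂ , dominated-vw (here refl) (there (here refl))
        corner-trail (inj₂ (inj₂ refl)) (inj₁ refl)        = side₃ j₃ , dominated-wu (here refl) (there (here refl))
        corner-trail (inj₂ (inj₂ refl)) (inj₂ (inj₁ refl)) = side₂ (joins-sym j₂) , dominated-vw (there (here refl)) (here refl)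
        corner-trail (inj₂ (inj₂ refl)) (inj₂ (inj₂ refl)) = loop-w , dominated-wu (here refl) (there (here refl))

        tour : Tour S K
        tour with two-edges-into-x S? ¬Sx closed c₁ ¬x₁ (corner (here refl) (inj₁ refl))
        ... | g , h , a , b , g≢h , jg , Sa , jh , Sb with corner-trail Sa Sb
        ... | P , domP = ear g≢h jg Sa jh Sb P domP

      -- Each half of the path is closed apart from the middle edge, which yields one ear
      -- edge from each half.
      module Path₃ {a b c d c₁ c₂ c₃} (j₁ : Joins H c₁ a b) (j₂ : Joins H c₂ b c) (j₃ : Joins H c₃ c d)
                   (a≢c : a ≢ c) (a≢d : a ≢ d) (b≢d : b ≢ d)
                   (¬x₁ : ¬ AtX c₁) (¬x₂ : ¬ AtX c₂) (¬x₃ : ¬ AtX c₃)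
                   (cov : Covers (c₁ ∷ c₂ ∷ c₃ ∷ [])) where

        K : List E
        K = c₁ ∷ c₂ ∷ c₃ ∷ []

        S₁ : V → Set
        S₁ y = (y ≡ a) ⊎ (y ≡ b)

        S₂ : V → Set
        S₂ y = (y ≡ c) ⊎ (y ≡ d)

        S : V → Set
        S y = S₁ y ⊎ S₂ y

        S₁? : Decidable S₁
        S₁? y = (y ≟ a) ⊎-dec (y ≟ b)

        S₂? : Decidable S₂
        S₂? y = (y ≟ c) ⊎-dec (y ≟ d)

        disjoint : ∀ {y} → S₁ y → S₂ y → ⊥
        disjoint (inj₁ refl) (inj₁ a≡c) = a≢c a≡c
        disjoint (inj₁ refl) (inj₂ a≡d) = a≢d a≡d
        disjoint (inj₂ refl) (inj₁ b≡c) = joins⇒≢ j₂ b≡c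
        disjoint (inj₂ refl) (inj₂ b≡d) = b≢d b≡d

        ¬S₁x : ¬ S₁ x
        ¬S₁x (inj₁ refl) = ¬x₁ (joins⇒endOfˡ j₁)
        ¬S₁x (inj₂ refl) = ¬x₁ (joins⇒endOfʳ j₁)

        ¬S₂x : ¬ S₂ x
        ¬S₂x (inj₁ refl) = ¬x₃ (joins⇒endOfˡ j₃)
        ¬S₂x (inj₂ refl) = ¬x₃ (joins⇒endOfʳ j₃)

        closed₁ : ClosedExcept c₂ S₁
        closed₁ {e} e≢c₂ je Se₁ ¬Se₂ with endOf? e x
        ... | yes ex = enters-x S₁ ¬S₁x je Se₁ ex
        ... | no ¬ex with cov e ¬ex
        ... | here refl                 = ⊥-elim (¬Se₂ (joins-endOf j₁ (joins⇒endOfʳ je)))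
        ... | there (here refl)         = ⊥-elim (e≢c₂ refl)
        ... | there (there (here refl)) = ⊥-elim (disjoint Se₁ (joins-endOf j₃ (joins⇒endOfˡ je)))

        closed₂ : ClosedExcept c₂ S₂
        closed₂ {e} e≢c₂ je Se₁ ¬Se₂ with endOf? e x
        ... | yes ex = enters-x S₂ ¬S₂x je Se₁ ex
        ... | no ¬ex with cov e ¬ex
        ... | here refl                 = ⊥-elim (disjoint (joins-endOf j₁ (joins⇒endOfˡ je)) Se₁)
        ... | there (here refl)         = ⊥-elim (e≢c₂ refl)
        ... | there (there (here refl)) = ⊥-elim (¬Se₂ (joins-endOf j₃ (joins⇒endOfʳ je)))

        c₁≢c₂ : c₁ ≢ c₂
        c₁≢c₂ = joins-≢ j₁ j₂ (≢-sym a≢c) (≢-sym (joins⇒≢ j₂))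

        c₁≢c₃ : c₁ ≢ c₃
        c₁≢c₃ = joins-≢ j₁ j₃ (≢-sym a≢d) (≢-sym b≢d)

        c₂≢c₃ : c₂ ≢ c₃
        c₂≢c₃ = joins-≢ j₂ j₃ (≢-sym b≢d) (≢-sym (joins⇒≢ j₃))

        Sa : S a
        Sa = inj₁ (inj₁ refl)

        Sb : S b
        Sb = inj₁ (inj₂ refl)

        Sc : S c
        Sc = inj₂ (inj₁ refl)

        Sd : S d
        Sd = inj₂ (inj₂ refl)

        within₁ : Within S c₁
        within₁ = within-joins j₁ Sa Sb

        within₂ : Within S c₂
        within₂ = within-joins j₂ Sb Sc

        within₃ : Within S c₃
        within₃ = within-joins j₃ Sc Sd

        trail-bc : InnerTrail S b c
        trail-bc = edge-trail j₂ ¬x₂ within₂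

        trail-bd : InnerTrail S b d
        trail-bd = step j₂ ¬x₂ within₂ (edge-trail j₃ ¬x₃ within₃) (∉₁ c₂≢c₃)

        dominated-bc : ∀ {vs} → b ∈ vs → c ∈ vs → DominatedBy K vs
        dominated-bc ib ic = endOf-dominates (joins⇒endOfʳ j₁) ib ∷ endOf-dominates (joins⇒endOfˡ j₂) ib
                           ∷ endOf-dominates (joins⇒endOfˡ j₃) ic ∷ []

        crossing-trail : ∀ {a' b'} → S₁ a' → S₂ b' →
                         Σ (InnerTrail S a' b') λ P → DominatedBy K (walkVertices (InnerTrail.walk P))
        crossing-trail (inj₁ refl) (inj₁ refl) =
          step j₁ ¬x₁ within₁ trail-bc (∉₁ c₁≢c₂) ,
          dominated-bc (there (here refl)) (there (there (here refl)))
        crossing-trail (inj₁ refl) (inj₂ refl) =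
          step j₁ ¬x₁ within₁ trail-bd (∉₂ c₁≢c₂ c₁≢c₃) ,
          dominated-bc (there (here refl)) (there (there (here refl)))
        crossing-trail (inj₂ refl) (inj₁ refl) = trail-bc , dominated-bc (here refl) (there (here refl))
        crossing-trail (inj₂ refl) (inj₂ refl) = trail-bd , dominated-bc (here refl) (there (here refl))

        tour : Tour S K
        tour with edge-into-x-avoiding S₁? ¬S₁x c₂ closed₁ c₁ c₁≢c₂ (joins-endOf j₁ (inj₁ refl))
                | edge-into-x-avoiding S₂? ¬S₂x c₂ closed₂ c₃ (≢-sym c₂≢c₃) (joins-endOf j₃ (inj₁ refl))
        ... | g , a₁ , jg , S₁a₁ | h , a₂ , jh , S₂a₂ with crossing-trail S₁a₁ S₂a₂
        ... | P , domP = ear g≢h jg (inj₁ S₁a₁) jh (inj₂ S₂a₂) P domP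
          where
          g≢h : g ≢ h
          g≢h = joins-≢ jg (joins-sym jh) (λ a₂≡a₁ → disjoint S₁a₁ (subst S₂ a₂≡a₁ S₂a₂))
                                          (λ a₂≡x → ¬S₂x (subst S₂ a₂≡x S₂a₂))

      single : ∀ {c} → ¬ AtX c → Solvable (c ∷ [])
      single ¬xc = star _ (here refl) (inj₁ refl ∷ []) (¬xc ∷ [])

      pair : ∀ {a b} → ShareEnd a b → ¬ AtX a → ¬ AtX b → Solvable (a ∷ b ∷ [])
      pair (y , ay , by) ¬xa ¬xb = star y (here refl) (ay ∷ by ∷ []) (¬xa ∷ ¬xb ∷ [])

      triangle : ∀ {a b c} → ShareEnd a b → ShareEnd a c → ShareEnd b c → ¬ CommonEnd a b c →
                 ¬ AtX a → ¬ AtX b → ¬ AtX c → Covers (a ∷ b ∷ c ∷ []) → DominatingTrailThrough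
      triangle (v , av , bv) (u , au , cu) (w , bw , cw) ¬abc ¬xa ¬xb ¬xc cov =
        tour⇒trail cov (Triangle.tour (endOf⇒joins au av u≢v) (endOf⇒joins bv bw v≢w) (endOf⇒joins cw cu w≢u)
                                      ¬xa ¬xb ¬xc cov)
        where
        u≢v : u ≢ v
        u≢v u≡v = ¬abc (v , av , bv , subst (EndOf _) u≡v cu)

        v≢w : v ≢ w
        v≢w v≡w = ¬abc (v , av , bv , subst (EndOf _) (sym v≡w) cw)

        w≢u : w ≢ u
        w≢u w≡u = ¬abc (u , au , subst (EndOf _) w≡u bw , cu)

      path : ∀ {a b c} → ShareEnd a b → ShareEnd b c → ¬ ShareEnd a c →
             ¬ AtX a → ¬ AtX b → ¬ AtX c → Covers (a ∷ b ∷ c ∷ []) → DominatingTrailThrough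
      path {a} {c = c} (s , as , bs) (t , bt , ct) ¬ac ¬xa ¬xb ¬xc cov with other-end as | other-end ct
      ... | r , ja | d , jc =
        tour⇒trail cov (Path₃.tour (joins-sym ja) (endOf⇒joins bs bt (ends-differ as ct)) jc
                                   (ends-differ ar ct) (ends-differ ar cd) (ends-differ as cd) ¬xa ¬xb ¬xc cov)
        where
        ends-differ : ∀ {y z} → EndOf a y → EndOf c z → y ≢ z
        ends-differ ay cz y≡z = ¬ac (_ , ay , subst (EndOf c) (sym y≡z) cz)

        ar : EndOf a r
        ar = joins⇒endOfʳ ja

        cd : EndOf c d
        cd = joins⇒endOfʳ jc

      three-edges : ∀ {a b c} → ¬ AtX a → ¬ AtX b → ¬ AtX c → Covers (a ∷ b ∷ c ∷ []) → DominatingTrailThrough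
      three-edges {a} {b} {c} ¬xa ¬xb ¬xc cov with commonEnd? a b c
      ... | yes (y , ay , by , cy) =
        solvable⇒trail cov (star y (here refl) (ay ∷ by ∷ cy ∷ []) (¬xa ∷ ¬xb ∷ ¬xc ∷ []))
      ... | no ¬abc with shareEnd? a b | shareEnd? a c | shareEnd? b c
      ... | yes ab | yes ac | yes bc = triangle ab ac bc ¬abc ¬xa ¬xb ¬xc cov
      ... | yes ab | no ¬ac | yes bc = path ab bc ¬ac ¬xa ¬xb ¬xc cov
      ... | yes ab | yes ac | no ¬bc = path (shareEnd-sym ab) ac ¬bc ¬xb ¬xa ¬xc (covers-↭ (↭-swap₁₂ a b c) cov)
      ... | no ¬ab | yes ac | yes bc = path ac (shareEnd-sym bc) ¬ab ¬xa ¬xc ¬xb (covers-↭ (↭-swap₂₃ a b c) cov)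
      ... | yes ab | no ¬ac | no ¬bc =
        solvable⇒trail cov (solvable-++ ((¬ac ∷ []) ∷ (¬bc ∷ []) ∷ []) (pair ab ¬xa ¬xb) (single ¬xc))
      ... | no ¬ab | yes ac | no ¬bc =
        solvable⇒trail (covers-↭ (↭-swap₂₃ a b c) cov)
          (solvable-++ ((¬ab ∷ []) ∷ (¬bc ∘ shareEnd-sym ∷ []) ∷ []) (pair ac ¬xa ¬xc) (single ¬xb))
      ... | no ¬ab | no ¬ac | yes bc =
        solvable⇒trail (covers-↭ (↭-rotate a b c) cov)
          (solvable-++ ((¬ab ∘ shareEnd-sym ∷ []) ∷ (¬ac ∘ shareEnd-sym ∷ []) ∷ [])
                       (pair bc ¬xb ¬xc) (single ¬xa))
      ... | no ¬ab | no ¬ac | no ¬bc =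
        solvable⇒trail cov
          (solvable-++ ((¬ab ∷ ¬ac ∷ []) ∷ []) (single ¬xa)
                       (solvable-++ ((¬bc ∷ []) ∷ []) (single ¬xb) (single ¬xc)))

      trail-from-edge-list : ∀ L → Covers L → All (λ e → ¬ AtX e) L → length L ≤ 3 → DominatingTrailThrough
      trail-from-edge-list [] cov [] _ = solvable⇒trail cov λ _ → mkTour (nil x) [] [] []
      trail-from-edge-list (a ∷ []) cov (¬xa ∷ []) _ = solvable⇒trail cov (single ¬xa)
      trail-from-edge-list (a ∷ b ∷ []) cov (¬xa ∷ ¬xb ∷ []) _ with shareEnd? a b
      ... | yes ab  = solvable⇒trail cov (pair ab ¬xa ¬xb)
      ... | no ¬ab = solvable⇒trail cov (solvable-++ ((¬ab ∷ []) ∷ []) (single ¬xa) (single ¬xb))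
      trail-from-edge-list (a ∷ b ∷ c ∷ []) cov (¬xa ∷ ¬xb ∷ ¬xc ∷ []) _ = three-edges ¬xa ¬xb ¬xc cov
      trail-from-edge-list (_ ∷ _ ∷ _ ∷ _ ∷ _) _ _ (s≤s (s≤s (s≤s ())))

lemma2 : (H : Multigraph) → EssKEdgeConnected 2 H → (x : Vertex H) →
    2 ≤ degree H x → edgesMinusVertex H x ≤ 3 →
    Σ (ClosedTrail H) λ T → Dominating H T × (x ∈ trailVertices T)
lemma2 H ess x 2≤deg ≤3 with two-distinct (filter (incident? H x) (allFin (m H)))
                                         (Unique.filter⁺ (incident? H x) (Unique.allFin⁺ (m H)))
                                         (All.all-filter (incident? H x) (allFin (m H))) 2≤deg
... | _ , _ , g₁≢g₂ , g₁x , g₂x =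
  trail-from-edge-list H x ess g₁≢g₂ g₁x g₂x (filter avoids-x? (allFin (m H)))
    (λ e ¬ex → ∈-filter⁺ avoids-x? (∈-allFin e) ¬ex) (All.all-filter avoids-x? (allFin (m H))) ≤3
  where
  avoids-x? : Decidable (λ e → ¬ AtX H x e)
  avoids-x? e = ¬? (incident? H x e)
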